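{- Let $X$ be a nonempty set and let $R$ be a ring of functions $X\to\mathbb{Z}$ containing all constant functions. Suppose $\varphi(\bar x)$ is an $\mathcal{L}^+_R$-formula such that (1) whenever a divisibility predicate $D_\alpha$ occurs in $\varphi$, $\alpha$ is a constant function; and (2) $\varphi$ contains no term of the form $f_\alpha(s)$ where $s$ contains a variable that is within the scope of a quantifier and $\alpha$ is not a constant function. Then $\varphi(\bar x)$ is logically equivalent to a quantifier-free $\mathcal{L}^+_R$-formula which also satisfies condition (1).
   Context: Languages: $\mathcal{L}_{Pres}=\{0,1,<,-,+\}$ (constants $0,1$, order, unary negation, binary addition); $\mathcal{L}^+_{Pres}=\mathcal{L}_{Pres}\cup\{D_n : n\in\mathbb{N}\}$ with $D_n$ a unary predicate for divisibility by $n$ ($D_0$ always false); $\mathcal{L}_R=\mathcal{L}_{Pres}\cup\{f_\alpha:\alpha\in R\}$ with $f_\alpha$ unary function symbols (written $\alpha\cdot s$), and $\mathcal{L}^+_R=\mathcal{L}_R\cup\{D_\alpha:\alpha\in R\}$ with $D_\alpha$ unary predicates. Semantics depend on a parameter $t\in X$: for an $\mathcal{L}^+_R$-formula $\varphi$, $\varphi_t$ is the $\mathcal{L}^+_{Pres}$-formula obtained by replacing each term $\alpha\cdot s$ by $s+\dots+s$ ($\alpha(t)$ copies) if $\alpha(t)>0$, by $-(s+\dots+s)$ ($|\alpha(t)|$ copies) if $\alpha(t)<0$, by $0$ if $\alpha(t)=0$, and each $D_\alpha(s)$ by $D_{\alpha(t)}(s)$ (always false if $\alpha(t)=0$); $\varphi_t$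 is interpreted in $\mathbb{Z}$. Two $\mathcal{L}^+_R$-formulas $\varphi(x_1,\dots,x_d)$, $\psi(x_1,\dots,x_d)$ are logically equivalent if for every $t\in X$ and every $(k_1,\dots,k_d)\in\mathbb{Z}^d$, $\varphi_t(k_1,\dots,k_d)$ holds in $\mathbb{Z}$ iff $\psi_t(k_1,\dots,k_d)$ holds. Quantifiers range over $\mathbb{Z}$ only, never over $t$. -}

module Defs where

open import Data.Nat using (ℕ; suc) renaming (_<_ to _<ℕ_)
open import Data.Fin using (Fin; toℕ; zero; suc)
open import Data.Integer using (ℤ; _+_; _*_; -_; _<_; 0ℤ; 1ℤ)
open import Data.Integer.Divisibility using (_∣_)
open import Data.Product using (Σ; _×_; _,_)
open import Data.Sum using (_⊎_)
open import Data.Empty using (⊥)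
open import Data.Unit using (⊤)
open import Relation.Nullary using (¬_)
open import Relation.Binary.PropositionalEquality using (_≡_; _≢_)
open import Function.Bundles using (_⇔_)

record FunRing (X : Set) : Set₁ where
  field
    Mem       : (X → ℤ) → Set
    const-mem : ∀ (c : ℤ) → Mem (λ _ → c)
    +-closed  : ∀ {f g} → Mem f → Mem g → Mem (λ x → f x + g x)
    *-closed  : ∀ {f g} → Mem f → Mem g → Mem (λ x → f x * g x)
    neg-closed : ∀ {f} → Mem f → Mem (λ x → - f x)

IsConst : {X : Set} → (X → ℤ) → Set
IsConst {X} α = Σ ℤ λ c → ∀ (x : X) → α x ≡ c

-- Syntax of L⁺_R (variables as de Bruijn indices; n = variables in scope)

module Syntax {X : Set} (R : FunRing X) where
  open FunRing R

  data Term (n : ℕ) : Set where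
    var  : Fin n → Term n
    zer  : Term n
    one  : Term n
    neg  : Term n → Term n
    add  : Term n → Term n → Term n
    smul : (α : X → ℤ) → Mem α → Term n → Term n   -- f_α(s) = α · s

  data Formula (n : ℕ) : Set where
    eqF  : Term n → Term n → Formula n
    ltF  : Term n → Term n → Formula n
    dvdF : (α : X → ℤ) → Mem α → Term n → Formula n
    notF : Formula n → Formula n
    andF : Formula n → Formula n → Formula n
    orF  : Formula n → Formula n → Formula n
    exF  : Formula (suc n) → Formula n         -- ∃ (binds de Bruijn var 0)
    allF : Formula (suc n) → Formula n

  -- Semantics at parameter t (this is exactly the interpretation of φ_t
  -- in ℤ: α·s becomes s+…+s (α(t) copies) = α(t)*s, and D_α(s) becomes
  -- D_{α(t)}(s), false when α(t)=0).

  extend : ∀ {n} → ℤ → (Fin n → ℤ) → Fin (suc n) → ℤ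
  extend k ρ zero    = k
  extend k ρ (suc i) = ρ i

  evalT : ∀ {n} → X → (Fin n → ℤ) → Term n → ℤ
  evalT t ρ (var i)      = ρ i
  evalT t ρ zer          = 0ℤ
  evalT t ρ one          = 1ℤ
  evalT t ρ (neg s)      = - evalT t ρ s
  evalT t ρ (add s s')   = evalT t ρ s + evalT t ρ s'
  evalT t ρ (smul α _ s) = α t * evalT t ρ s

  Sat : ∀ {n} → X → (Fin n → ℤ) → Formula n → Set
  Sat t ρ (eqF s s')     = evalT t ρ s ≡ evalT t ρ s'
  Sat t ρ (ltF s s')     = evalT t ρ s < evalT t ρ s'
  Sat t ρ (dvdF α _ s)   = (α t ≢ 0ℤ) × (α t ∣ evalT t ρ s)
  Sat t ρ (notF φ)       = ¬ Sat t ρ φ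
  Sat t ρ (andF φ ψ)     = Sat t ρ φ × Sat t ρ ψ
  Sat t ρ (orF φ ψ)      = Sat t ρ φ ⊎ Sat t ρ ψ
  Sat t ρ (exF φ)        = Σ ℤ λ k → Sat t (extend k ρ) φ
  Sat t ρ (allF φ)       = ∀ (k : ℤ) → Sat t (extend k ρ) φ

  LogEquiv : ∀ {n} → Formula n → Formula n → Set
  LogEquiv {n} φ ψ = ∀ (t : X) (ρ : Fin n → ℤ) → Sat t ρ φ ⇔ Sat t ρ ψ

  QF : ∀ {n} → Formula n → Set
  QF (eqF _ _)    = ⊤
  QF (ltF _ _)    = ⊤
  QF (dvdF _ _ _) = ⊤
  QF (notF φ)     = QF φ
  QF (andF φ ψ)   = QF φ × QF ψ
  QF (orF φ ψ)    = QF φ × QF ψ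
  QF (exF _)      = ⊥
  QF (allF _)     = ⊥

  Cond1 : ∀ {n} → Formula n → Set
  Cond1 (eqF _ _)    = ⊤
  Cond1 (ltF _ _)    = ⊤
  Cond1 (dvdF α _ _) = IsConst α
  Cond1 (notF φ)     = Cond1 φ
  Cond1 (andF φ ψ)   = Cond1 φ × Cond1 ψ
  Cond1 (orF φ ψ)    = Cond1 φ × Cond1 ψ
  Cond1 (exF φ)      = Cond1 φ
  Cond1 (allF φ)     = Cond1 φ

  -- The index k counts the quantifiers
  -- enclosing the current position; de Bruijn variables with index < k are
  -- exactly the bound ones.

  HasBound : ∀ {n} → ℕ → Term n → Set
  HasBound k (var i)      = toℕ i <ℕ k
  HasBound k zer          = ⊥
  HasBound k one          = ⊥
  HasBound k (neg s)      = HasBound k s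
  HasBound k (add s s')   = HasBound k s ⊎ HasBound k s'
  HasBound k (smul _ _ s) = HasBound k s

  Cond2T : ∀ {n} → ℕ → Term n → Set
  Cond2T k (var _)      = ⊤
  Cond2T k zer          = ⊤
  Cond2T k one          = ⊤
  Cond2T k (neg s)      = Cond2T k s
  Cond2T k (add s s')   = Cond2T k s × Cond2T k s'
  Cond2T k (smul α _ s) = (HasBound k s → IsConst α) × Cond2T k s

  Cond2 : ∀ {n} → ℕ → Formula n → Set
  Cond2 k (eqF s s')   = Cond2T k s × Cond2T k s'
  Cond2 k (ltF s s')   = Cond2T k s × Cond2T k s'
  Cond2 k (dvdF _ _ s) = Cond2T k s
  Cond2 k (notF φ)     = Cond2 k φ
  Cond2 k (andF φ ψ)   = Cond2 k φ × Cond2 k ψ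
  Cond2 k (orF φ ψ)    = Cond2 k φ × Cond2 k ψ
  Cond2 k (exF φ)      = Cond2 (suc k) φ
  Cond2 k (allF φ)     = Cond2 (suc k) φ

-- Cooper's quantifier elimination for Presburger arithmetic, run uniformly in the parameter t.
-- Eliminating the innermost bound variable y, condition (2) makes every term linear in y with an
-- integer coefficient, and condition (1) makes every divisibility modulus an integer.  Scaling y by
-- the product L of the coefficients turns every constraint on Y = L·y into 0 < Y + b, 0 < b - Y,
-- 0 < b or D_m(c·Y + b), plus L ∣ Y.  Cooper's lemma then replaces ∃Y by the finite disjunction of
-- the instances at Y = j of the formula "at -∞" and at Y = j - b for each lower bound b, with j
-- running over 1, …, D for a common multiple D of the moduli.  These instances only multiply by
-- integer constants, so conditions (1) and (2) survive and the elimination can be iterated; ∀ is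
-- ¬∃¬, which is sound because quantifier-free formulas are decidable.

module Submission where

open import Defs

open import Data.Empty using (⊥; ⊥-elim)
open import Data.Fin using (Fin; zero; suc; toℕ)
open import Data.Integer
  using (ℤ; +_; -[1+_]; +[1+_]; _+_; _-_; -_; _*_; _<_; _≤_; 0ℤ; 1ℤ; -1ℤ; ∣_∣; +<+; +≤+; -≤+)
import Data.Integer.DivMod as ℤ
open import Data.Integer.Divisibility using (_∣_)
import Data.Integer.Divisibility as ℤ
import Data.Integer.Divisibility.Signed as Signed
import Data.Integer.Properties as ℤ
open import Data.Integer.Tactic.RingSolver using (solve-∀)
open import Data.List using (List; []; _∷_; [_]; _++_; map; applyUpTo)
open import Data.List.Membership.Propositional.Properties using (∈-map⁺)
open import Data.List.Relation.Unary.All as All using (All; []; _∷_)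
import Data.List.Relation.Unary.All.Properties as All
open import Data.List.Relation.Unary.Any as Any using (Any; here; there)
import Data.List.Relation.Unary.Any.Properties as Any
open import Data.Nat as ℕ using (ℕ; zero; suc; NonZero; z≤n; s≤s)
import Data.Nat.DivMod as ℕ
import Data.Nat.Divisibility as ℕ
open import Data.Nat.ListAction using (sum; product)
open import Data.Nat.ListAction.Properties using (product≢0; ∈⇒∣product)
import Data.Nat.Properties as ℕ
open import Data.Product using (Σ; ∃; _×_; _,_; proj₁; proj₂)
open import Data.Product.Function.Dependent.Propositional using (Σ-⇔)
open import Data.Product.Function.NonDependent.Propositional using (_×-⇔_)
open import Data.Sum as ⊎ using (_⊎_; inj₁; inj₂; [_,_]′)
open import Data.Sum.Function.Propositional using (_⊎-⇔_)
open import Data.Unit using (⊤; tt)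
open import Function using (_∘_; it)
open import Function.Bundles using (_⇔_; mk⇔; Equivalence)
open import Function.Construct.Composition using (_⇔-∘_)
open import Function.Construct.Identity using (⇔-id; ↠-id)
open import Function.Construct.Symmetry using (⇔-sym)
open import Function.Related.Propositional using (module EquationalReasoning)
open import Function.Related.TypeIsomorphisms using (¬-cong-⇔)
open import Relation.Binary.PropositionalEquality
  using (_≡_; _≢_; refl; sym; trans; cong; cong₂; subst; subst₂; module ≡-Reasoning)
open import Relation.Nullary using (¬_; Dec; yes; no)
open import Relation.Nullary.Decidable using (_×-dec_; _⊎-dec_; ¬?; decidable-stable)

open Equivalence using (to; from)

∃-cong : ∀ {A : Set} {P Q : A → Set} → (∀ x → P x ⇔ Q x) → ∃ P ⇔ ∃ Q
∃-cong P⇔Q = Σ-⇔ (↠-id _) (λ {x} → P⇔Q x)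

∀-cong : ∀ {A : Set} {P Q : A → Set} → (∀ x → P x ⇔ Q x) → (∀ x → P x) ⇔ (∀ x → Q x)
∀-cong P⇔Q = mk⇔ (λ p x → to (P⇔Q x) (p x)) (λ q x → from (P⇔Q x) (q x))

∀⇔¬∃¬ : ∀ {A : Set} {P : A → Set} → (∀ x → Dec (P x)) → (∀ x → P x) ⇔ (¬ ∃ λ x → ¬ P x)
∀⇔¬∃¬ P? = mk⇔ (λ p (x , ¬p) → ¬p (p x))
                (λ ¬∃¬ x → decidable-stable (P? x) (λ ¬p → ¬∃¬ (x , ¬p)))

data AndOr (A : Set) : Set where
  atom    : A → AndOr A
  _∧_ _∨_ : AndOr A → AndOr A → AndOr A

variable
  A B : Set
  P Q : A → Set

atoms : AndOr A → List A
atoms (atom a) = [ a ]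
atoms (F ∧ G)  = atoms F ++ atoms G
atoms (F ∨ G)  = atoms F ++ atoms G

Holds : (A → Set) → AndOr A → Set
Holds P (atom a) = P a
Holds P (F ∧ G)  = Holds P F × Holds P G
Holds P (F ∨ G)  = Holds P F ⊎ Holds P G

holds-mono : ∀ F → All (λ a → P a → Q a) (atoms F) → Holds P F → Holds Q F
holds-mono (atom a) (f ∷ []) = f
holds-mono (F ∧ G) fs (p , q) with All.++⁻ (atoms F) fs
... | fF , fG = holds-mono F fF p , holds-mono G fG q
holds-mono (F ∨ G) fs p with All.++⁻ (atoms F) fs
... | fF , fG = [ inj₁ ∘ holds-mono F fF , inj₂ ∘ holds-mono G fG ]′ p

holds-cong : ∀ F → All (λ a → P a ⇔ Q a) (atoms F) → Holds P F ⇔ Holds Q F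
holds-cong F P⇔Q = mk⇔ (holds-mono F (All.map to P⇔Q)) (holds-mono F (All.map from P⇔Q))

holds? : (∀ a → Dec (P a)) → ∀ F → Dec (Holds P F)
holds? P? (atom a) = P? a
holds? P? (F ∧ G)  = holds? P? F ×-dec holds? P? G
holds? P? (F ∨ G)  = holds? P? F ⊎-dec holds? P? G

mapᴬ : (A → B) → AndOr A → AndOr B
mapᴬ f (atom a) = atom (f a)
mapᴬ f (F ∧ G)  = mapᴬ f F ∧ mapᴬ f G
mapᴬ f (F ∨ G)  = mapᴬ f F ∨ mapᴬ f G

holds-map : ∀ (f : A → B) F → Holds P (mapᴬ f F) ⇔ Holds (P ∘ f) F
holds-map f (atom a) = ⇔-id _
holds-map f (F ∧ G)  = holds-map f F ×-⇔ holds-map f G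
holds-map f (F ∨ G)  = holds-map f F ⊎-⇔ holds-map f G

dual : (A → A) → AndOr A → AndOr A
dual neg (atom a) = atom (neg a)
dual neg (F ∧ G)  = dual neg F ∨ dual neg G
dual neg (F ∨ G)  = dual neg F ∧ dual neg G

holds-dual : ∀ {neg : A → A} → (∀ a → Dec (P a)) → (∀ a → P (neg a) ⇔ (¬ P a)) →
             ∀ F → Holds P (dual neg F) ⇔ (¬ Holds P F)
holds-dual P? negP (atom a) = negP a
holds-dual P? negP (F ∧ G) = mk⇔
  [ (λ ¬f (f , _) → ¬f f) ∘ to dF , (λ ¬g (_ , g) → ¬g g) ∘ to dG ]′
  (⊎.map (from dF) (from dG) ∘ ¬×⇒¬⊎¬ (holds? P? F))
  where
    dF = holds-dual P? negP F
    dG = holds-dual P? negP G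
    ¬×⇒¬⊎¬ : ∀ {S T : Set} → Dec S → ¬ (S × T) → ¬ S ⊎ ¬ T
    ¬×⇒¬⊎¬ (yes s) ¬st = inj₂ λ t → ¬st (s , t)
    ¬×⇒¬⊎¬ (no ¬s) _   = inj₁ ¬s
holds-dual P? negP (F ∨ G) = mk⇔
  (λ (f , g) → [ to dF f , to dG g ]′)
  (λ ¬f∨g → from dF (¬f∨g ∘ inj₁) , from dG (¬f∨g ∘ inj₂))
  where
    dF = holds-dual P? negP F
    dG = holds-dual P? negP G

<⇔0<- : ∀ {x y} → x < y ⇔ 0ℤ < y - x
<⇔0<- {x} {y} = mk⇔
  (λ x<y → subst (_< y - x) (ℤ.+-inverseʳ x) (ℤ.+-monoˡ-< (- x) x<y))
  (λ 0<y-x → subst₂ _<_ (ℤ.+-identityˡ x) (y-x+x y x) (ℤ.+-monoˡ-< x 0<y-x))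
  where y-x+x : ∀ y x → y - x + x ≡ y
        y-x+x = solve-∀

≮0⇔0<1- : ∀ {x} → (¬ 0ℤ < x) ⇔ 0ℤ < 1ℤ - x
≮0⇔0<1- = <⇔0<- ⇔-∘ mk⇔ (λ 0≮x → ℤ.≤-<-trans (ℤ.≮⇒≥ 0≮x) (+<+ (s≤s z≤n)))
                         (λ x<1 → ℤ.≤⇒≯ (ℤ.i<j⇒i≤pred[j] x<1))

≡⇔≮×≯ : ∀ {x y} → x ≡ y ⇔ (¬ x < y × ¬ y < x)
≡⇔≮×≯ = mk⇔ (λ { refl → ℤ.<-irrefl refl , ℤ.<-irrefl refl })
             (λ (x≮y , y≮x) → ℤ.≤-antisym (ℤ.≮⇒≥ y≮x) (ℤ.≮⇒≥ x≮y))

0<*⇔0< : ∀ q .{{_ : NonZero q}} {x} → 0ℤ < + q * x ⇔ 0ℤ < x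
0<*⇔0< (suc q) {x} = mk⇔
  (λ 0<qx → ℤ.*-cancelˡ-<-nonNeg (+ suc q) (subst (_< + suc q * x) (sym (ℤ.*-zeroʳ (+ suc q))) 0<qx))
  (λ 0<x → subst (_< + suc q * x) (ℤ.*-zeroʳ (+ suc q)) (ℤ.*-monoˡ-<-pos (+ suc q) 0<x))

i≤+∣i∣ : ∀ i → i ≤ + ∣ i ∣
i≤+∣i∣ (+ n)    = ℤ.≤-refl
i≤+∣i∣ -[1+ n ] = -≤+

-∣i∣≤i : ∀ i → - + ∣ i ∣ ≤ i
-∣i∣≤i (+ n)    = ℤ.neg-≤-pos
-∣i∣≤i -[1+ n ] = ℤ.≤-refl

shift-below : ∀ D .{{_ : NonZero D}} j x → ∃ λ z → j + + D * z < x
shift-below D j x = - + suc a , (begin-strict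
    j + + D * - + suc a  ≤⟨ ℤ.+-monoʳ-≤ j D*z≤z ⟩
    j + - + suc a        <⟨ ℤ.+-monoʳ-< j (ℤ.neg-mono-< (+<+ (ℕ.n<1+n a))) ⟩
    j + - + a            ≤⟨ ℤ.+-monoʳ-≤ j (-∣i∣≤i (x - j)) ⟩
    j + (x - j)          ≡⟨ j+[x-j]≡x j x ⟩
    x                    ∎)
  where
    open ℤ.≤-Reasoning
    a = ∣ x - j ∣
    j+[x-j]≡x : ∀ j x → j + (x - j) ≡ x
    j+[x-j]≡x = solve-∀
    D*z≤z : + D * - + suc a ≤ - + suc a
    D*z≤z = subst (_≤ - + suc a) (trans (cong -_ (ℤ.pos-* D (suc a))) (ℤ.neg-distribʳ-* (+ D) (+ suc a)))
                  (ℤ.neg-mono-≤ (+≤+ (ℕ.m≤n*m (suc a) D)))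

D⟨_⟩ : ℤ → ℤ → Set
D⟨ m ⟩ x = m ≢ 0ℤ × m ∣ x

D? : ∀ m x → Dec (D⟨ m ⟩ x)
D? m x = ¬? (m ℤ.≟ 0ℤ) ×-dec (∣ m ∣ ℕ.∣? ∣ x ∣)

D-scale : ∀ q .{{_ : NonZero q}} {m x} → D⟨ m ⟩ x ⇔ D⟨ + q * m ⟩ (+ q * x)
D-scale (suc q) {m} {x} = mk⇔
  (λ (m≢0 , m∣x) → [ (λ ()) , m≢0 ]′ ∘ ℤ.i*j≡0⇒i≡0∨j≡0 (+ suc q)
                  , ℤ.*-monoʳ-∣ (+ suc q) {m} {x} m∣x)
  (λ (qm≢0 , qm∣qx) → (λ m≡0 → qm≢0 (trans (cong (+ suc q *_) m≡0) (ℤ.*-zeroʳ (+ suc q))))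
                     , ℤ.*-cancelˡ-∣ (+ suc q) {m} {x} qm∣qx)

D-shift : ∀ {m D} x z → ∣ m ∣ ℕ.∣ D → D⟨ m ⟩ x ⇔ D⟨ m ⟩ (x + + D * z)
D-shift {m} {D} x z m∣D = mk⇔
  (λ (m≢0 , m∣x) →
     m≢0 , Signed.∣⇒∣ᵤ (Signed.∣m∣n⇒∣m+n (Signed.∣ᵤ⇒∣ {m} {x} m∣x) m∣Dz))
  (λ (m≢0 , m∣x+Dz) →
     m≢0 , Signed.∣⇒∣ᵤ (Signed.∣m+n∣n⇒∣m {m} {x} (Signed.∣ᵤ⇒∣ {m} {x + + D * z} m∣x+Dz) m∣Dz))
  where m∣Dz = Signed.∣m⇒∣m*n z (Signed.∣ᵤ⇒∣ {m} {+ D} m∣D)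

∃-scale : ∀ L .{{_ : NonZero L}} (P : ℤ → Set) →
          (∃ λ y → P (+ L * y)) ⇔ (∃ λ Y → D⟨ + L ⟩ Y × P Y)
∃-scale L@(suc _) P = mk⇔
  (λ (y , p) → + L * y , ((λ ()) , Signed.∣⇒∣ᵤ (Signed.∣m⇒∣m*n y (Signed.∣-refl {+ L}))) , p)
  (λ (Y , (_ , L∣Y) , p) → let Signed.divides q Y≡qL = Signed.∣ᵤ⇒∣ {+ L} {Y} L∣Y
                           in q , subst P (trans Y≡qL (ℤ.*-comm q (+ L))) p)

-- Like ∣_∣, except that 0 is sent to 1, so that it is always a legitimate scaling factor.
∣_∣⁺ : ℤ → ℕ
∣ + zero ∣⁺   = 1
∣ +[1+ n ] ∣⁺ = suc n
∣ -[1+ n ] ∣⁺ = suc n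

∣∣⁺-nonZero : ∀ i → NonZero ∣ i ∣⁺
∣∣⁺-nonZero (+ zero) = _
∣∣⁺-nonZero +[1+ n ] = _
∣∣⁺-nonZero -[1+ n ] = _

signum : ℤ → ℤ
signum (+ zero) = 0ℤ
signum +[1+ n ] = 1ℤ
signum -[1+ n ] = -1ℤ

cofactor : ℕ → ℤ → ℕ
cofactor L c = (L ℕ./ ∣ c ∣⁺) {{∣∣⁺-nonZero c}}

cofactor*∣∣⁺ : ∀ {L} c → ∣ c ∣⁺ ℕ.∣ L → cofactor L c ℕ.* ∣ c ∣⁺ ≡ L
cofactor*∣∣⁺ c c∣L = ℕ.m/n*n≡m {{∣∣⁺-nonZero c}} c∣L

cofactor-nonZero : ∀ {L} .{{_ : NonZero L}} c → ∣ c ∣⁺ ℕ.∣ L → NonZero (cofactor L c)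
cofactor-nonZero {L} c c∣L =
  ℕ.m*n≢0⇒m≢0 (cofactor L c) {{subst NonZero (sym (cofactor*∣∣⁺ c c∣L)) it}}

cofactor-* : ∀ {L} c → ∣ c ∣⁺ ℕ.∣ L → + cofactor L c * c ≡ signum c * + L
cofactor-* {L} (+ zero) _ = trans (ℤ.*-zeroʳ (+ cofactor L 0ℤ)) (sym (ℤ.*-zeroˡ (+ L)))
cofactor-* {L} c@(+[1+ n ]) c∣L = begin
  + cofactor L c * + suc n    ≡⟨ ℤ.pos-* (cofactor L c) (suc n) ⟨
  + (cofactor L c ℕ.* suc n)  ≡⟨ cong +_ (cofactor*∣∣⁺ c c∣L) ⟩
  + L                         ≡⟨ ℤ.*-identityˡ (+ L) ⟨
  1ℤ * + L                    ∎
  where open ≡-Reasoning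
cofactor-* {L} c@(-[1+ n ]) c∣L = begin
  + cofactor L c * - + suc n    ≡⟨ ℤ.neg-distribʳ-* (+ cofactor L c) (+ suc n) ⟨
  - (+ cofactor L c * + suc n)  ≡⟨ cong -_ (ℤ.pos-* (cofactor L c) (suc n)) ⟨
  - + (cofactor L c ℕ.* suc n)  ≡⟨ cong (-_ ∘ +_) (cofactor*∣∣⁺ c c∣L) ⟩
  - + L                         ≡⟨ ℤ.-1*i≡-i (+ L) ⟨
  -1ℤ * + L                     ∎
  where open ≡-Reasoning

cofactor-linear : ∀ {L} c y e → ∣ c ∣⁺ ℕ.∣ L →
                  + cofactor L c * (c * y + e) ≡ signum c * (+ L * y) + + cofactor L c * e
cofactor-linear {L} c y e c∣L = begin
  q * (c * y + e)               ≡⟨ distrib q c y e ⟩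
  q * c * y + q * e             ≡⟨ cong (λ x → x * y + q * e) (cofactor-* c c∣L) ⟩
  signum c * + L * y + q * e    ≡⟨ cong (_+ q * e) (ℤ.*-assoc (signum c) (+ L) y) ⟩
  signum c * (+ L * y) + q * e  ∎
  where open ≡-Reasoning
        q = + cofactor L c
        distrib : ∀ q c y e → q * (c * y + e) ≡ q * c * y + q * e
        distrib = solve-∀

window : ℕ → List ℤ
window D = applyUpTo (λ i → + suc i) D

window-any : ∀ {P : ℤ → Set} {D x} → 0ℤ < x → x ≤ + D → P x → Any P (window D)
window-any {x = +[1+ i ]} _ (+≤+ i<D) Px = Any.applyUpTo⁺ (λ i → + suc i) Px i<D
window-any {x = + zero} (+<+ ()) _ _

-- The representative of y in the window is 1 + (y - 1) mod D.
window-periodic : ∀ {P : ℤ → Set} D .{{_ : NonZero D}} →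
                  (∀ y z → P y → P (y + + D * z)) → ∀ y → P y → Any P (window D)
window-periodic {P} D P-periodic y Py =
  Any.applyUpTo⁺ (λ i → + suc i) (subst P shift≡ (P-periodic y (- q) Py)) (ℤ.n%d<d (y - 1ℤ) (+ D))
  where
    r = (y - 1ℤ) ℤ.% + D
    q = (y - 1ℤ) ℤ./ + D
    reassoc : ∀ y q D → y + D * - q ≡ 1ℤ + ((y - 1ℤ) - q * D)
    reassoc = solve-∀
    cancel : ∀ r q D → 1ℤ + ((r + q * D) - q * D) ≡ 1ℤ + r
    cancel = solve-∀
    shift≡ : y + + D * - q ≡ + suc r
    shift≡ = begin
      y + + D * - q
        ≡⟨ reassoc y q (+ D) ⟩
      1ℤ + ((y - 1ℤ) - q * + D)
        ≡⟨ cong (λ w → 1ℤ + (w - q * + D)) (ℤ.a≡a%n+[a/n]*n (y - 1ℤ) (+ D)) ⟩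
      1ℤ + ((+ r + q * + D) - q * + D)
        ≡⟨ cancel (+ r) q (+ D) ⟩
      1ℤ + + r
        ∎
      where open ≡-Reasoning

≤-sum : ∀ (f : A → ℕ) xs → All (λ x → f x ℕ.≤ sum (map f xs)) xs
≤-sum f []       = []
≤-sum f (x ∷ xs) = ℕ.m≤m+n (f x) _ ∷ All.map (λ h → ℕ.≤-trans h (ℕ.m≤n+m _ (f x))) (≤-sum f xs)

∣-product : ∀ (f : A → ℕ) xs → All (λ x → f x ℕ.∣ product (map f xs)) xs
∣-product f xs = All.tabulate (λ x∈xs → ∈⇒∣product (∈-map⁺ f x∈xs))

product-nonZero : ∀ (f : A → ℕ) → (∀ x → NonZero (f x)) → ∀ xs → NonZero (product (map f xs))
product-nonZero f f≢0 xs = product≢0 (All.map⁺ (All.universal f≢0 xs))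

-- Cooper's lemma

data Constraint (V : Set) : Set where
  lower upper const : V → Constraint V
  dvd ndvd          : ℤ → ℤ → V → Constraint V

mapᶜ : ∀ {V W : Set} → (V → W) → Constraint V → Constraint W
mapᶜ f (lower b)    = lower (f b)
mapᶜ f (upper b)    = upper (f b)
mapᶜ f (const b)    = const (f b)
mapᶜ f (dvd m c b)  = dvd m c (f b)
mapᶜ f (ndvd m c b) = ndvd m c (f b)

_⊨_ : ℤ → Constraint ℤ → Set
y ⊨ lower b    = 0ℤ < y + b
y ⊨ upper b    = 0ℤ < - y + b
y ⊨ const b    = 0ℤ < b
y ⊨ dvd m c b  = D⟨ m ⟩ (c * y + b)
y ⊨ ndvd m c b = ¬ D⟨ m ⟩ (c * y + b)

signed : ∀ {V} → ℤ → V → Constraint V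
signed (+ zero) b = const b
signed +[1+ _ ] b = lower b
signed -[1+ _ ] b = upper b

signed-⊨ : ∀ c y b → y ⊨ signed c b ⇔ 0ℤ < signum c * y + b
signed-⊨ (+ zero) y b = subst (λ x → 0ℤ < b ⇔ 0ℤ < x) (sym (ℤ.+-identityˡ b)) (⇔-id _)
signed-⊨ +[1+ _ ] y b = subst (λ x → 0ℤ < y + b ⇔ 0ℤ < x + b) (sym (ℤ.*-identityˡ y)) (⇔-id _)
signed-⊨ -[1+ _ ] y b = subst (λ x → 0ℤ < - y + b ⇔ 0ℤ < x + b) (sym (ℤ.-1*i≡-i y)) (⇔-id _)

mapᶜ-signed : ∀ {V W : Set} (f : V → W) c b → mapᶜ f (signed c b) ≡ signed c (f b)
mapᶜ-signed f (+ zero) b = refl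
mapᶜ-signed f +[1+ _ ] b = refl
mapᶜ-signed f -[1+ _ ] b = refl

period : ∀ {V} → Constraint V → ℕ
period (dvd m _ _)  = ∣ m ∣⁺
period (ndvd m _ _) = ∣ m ∣⁺
period _            = 1

period-nonZero : ∀ {V} (c : Constraint V) → NonZero (period c)
period-nonZero (lower _)    = _
period-nonZero (upper _)    = _
period-nonZero (const _)    = _
period-nonZero (dvd m _ _)  = ∣∣⁺-nonZero m
period-nonZero (ndvd m _ _) = ∣∣⁺-nonZero m

period-mapᶜ : ∀ {V W : Set} (f : V → W) c → period (mapᶜ f c) ≡ period c
period-mapᶜ f (lower b)    = refl
period-mapᶜ f (upper b)    = refl
period-mapᶜ f (const b)    = refl
period-mapᶜ f (dvd m c b)  = refl
period-mapᶜ f (ndvd m c b) = refl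

-- The constraint as y → -∞: lower bounds fail, upper bounds hold.
minusInf : Constraint ℤ → Constraint ℤ
minusInf (lower _) = const 0ℤ
minusInf (upper _) = const 1ℤ
minusInf c         = c

OnLower OnUpper IsLower : (ℤ → Set) → Constraint ℤ → Set
OnLower P (lower b) = P b
OnLower P _         = ⊤
OnUpper P (upper b) = P b
OnUpper P _         = ⊤
IsLower P (lower b) = P b
IsLower P _         = ⊥

isLower? : ∀ {P} → (∀ b → Dec (P b)) → ∀ c → Dec (IsLower P c)
isLower? P? (lower b)    = P? b
isLower? P? (upper b)    = no λ ()
isLower? P? (const b)    = no λ ()
isLower? P? (dvd m c b)  = no λ ()
isLower? P? (ndvd m c b) = no λ ()

module _ (D : ℕ) .{{_ : NonZero D}} where

  D⁺-shift : ∀ m x z → ∣ m ∣⁺ ℕ.∣ D → D⟨ m ⟩ x ⇔ D⟨ m ⟩ (x + + D * z)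
  D⁺-shift (+ zero) x z _   = mk⇔ (λ (0≢0 , _) → ⊥-elim (0≢0 refl)) (λ (0≢0 , _) → ⊥-elim (0≢0 refl))
  D⁺-shift +[1+ _ ] x z m∣D = D-shift x z m∣D
  D⁺-shift -[1+ _ ] x z m∣D = D-shift x z m∣D

  dvd-periodic : ∀ m c b y z → ∣ m ∣⁺ ℕ.∣ D → D⟨ m ⟩ (c * y + b) ⇔ D⟨ m ⟩ (c * (y + + D * z) + b)
  dvd-periodic m c b y z m∣D =
    subst (λ x → D⟨ m ⟩ (c * y + b) ⇔ D⟨ m ⟩ x) (sym (distrib c y b (+ D) z))
          (D⁺-shift m (c * y + b) (c * z) m∣D)
    where distrib : ∀ c y b D z → c * (y + D * z) + b ≡ (c * y + b) + D * (c * z)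
          distrib = solve-∀

  minusInf-periodic : ∀ c y z → period c ℕ.∣ D → y ⊨ minusInf c → (y + + D * z) ⊨ minusInf c
  minusInf-periodic (lower b)    y z _   = λ h → h
  minusInf-periodic (upper b)    y z _   = λ h → h
  minusInf-periodic (const b)    y z _   = λ h → h
  minusInf-periodic (dvd m c b)  y z m∣D = to (dvd-periodic m c b y z m∣D)
  minusInf-periodic (ndvd m c b) y z m∣D = λ ¬d d → ¬d (from (dvd-periodic m c b y z m∣D) d)

  step-down : ∀ c y → period c ℕ.∣ D → OnLower (λ b → 0ℤ < y + b → + D < y + b) c →
              y ⊨ c → (y - + D) ⊨ c
  step-down (lower b) y _ far 0<y+b =
    subst (0ℤ <_) (shuffle y b (+ D)) (to <⇔0<- (far 0<y+b))
    where shuffle : ∀ y b D → y + b - D ≡ y - D + b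
          shuffle = solve-∀
  step-down (upper b) y _ _ 0<-y+b =
    subst (0ℤ <_) (shuffle y b (+ D)) (ℤ.+-mono-<-≤ 0<-y+b (+≤+ z≤n))
    where shuffle : ∀ y b D → (- y + b) + D ≡ - (y - D) + b
          shuffle = solve-∀
  step-down (const b) y _ _ = λ h → h
  step-down (dvd m c b) y m∣D _ =
    subst (λ y′ → D⟨ m ⟩ (c * y′ + b)) (y-D y (+ D)) ∘ to (dvd-periodic m c b y -1ℤ m∣D)
    where y-D : ∀ y D → y + D * -1ℤ ≡ y - D
          y-D = solve-∀
  step-down (ndvd m c b) y m∣D _ ¬d d =
    ¬d (from (dvd-periodic m c b y -1ℤ m∣D) (subst (λ y′ → D⟨ m ⟩ (c * y′ + b)) (sym (y-D y (+ D))) d))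
    where y-D : ∀ y D → y + D * -1ℤ ≡ y - D
          y-D = solve-∀

  to-minusInf : ∀ c y → OnLower (λ b → y + b ≤ 0ℤ) c → y ⊨ c → y ⊨ minusInf c
  to-minusInf (lower b)    y y+b≤0 0<y+b = ⊥-elim (ℤ.≤⇒≯ y+b≤0 0<y+b)
  to-minusInf (upper b)    y _ _ = +<+ (s≤s z≤n)
  to-minusInf (const b)    y _ h = h
  to-minusInf (dvd m c b)  y _ h = h
  to-minusInf (ndvd m c b) y _ h = h

  from-minusInf : ∀ c y → OnUpper (λ b → y ⊨ upper b) c → y ⊨ minusInf c → y ⊨ c
  from-minusInf (lower b)    y _ 0<0 = ⊥-elim (ℤ.<-irrefl refl 0<0)
  from-minusInf (upper b)    y h _ = h
  from-minusInf (const b)    y _ h = h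
  from-minusInf (dvd m c b)  y _ h = h
  from-minusInf (ndvd m c b) y _ h = h

module Cooper (⟦_⟧ : A → Constraint ℤ) (G : AndOr A) (D : ℕ) .{{_ : NonZero D}}
              (periods : All (λ a → period ⟦ a ⟧ ℕ.∣ D) (atoms G)) where

  Sol Sol∞ : ℤ → Set
  Sol  y = Holds (λ a → y ⊨ ⟦ a ⟧) G
  Sol∞ y = Holds (λ a → y ⊨ minusInf ⟦ a ⟧) G

  LowerWitness : Constraint ℤ → Set
  LowerWitness = IsLower (λ b → Any (λ j → Sol (j - b)) (window D))

  Disjunction : Set
  Disjunction = Any Sol∞ (window D) ⊎ Any (LowerWitness ∘ ⟦_⟧) (atoms G)

  sol∞-periodic : ∀ y z → Sol∞ y → Sol∞ (y + + D * z)
  sol∞-periodic y z = holds-mono G (All.map (λ {a} → minusInf-periodic D ⟦ a ⟧ y z) periods)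

  Hit : ℤ → ℤ → Set
  Hit y b = 0ℤ < y + b × y + b ≤ + D

  hit? : ∀ y b → Dec (Hit y b)
  hit? y b = (0ℤ ℤ.<? y + b) ×-dec (y + b ℤ.≤? + D)

  hit⇒witness : ∀ y c → Sol y → IsLower (Hit y) c → LowerWitness c
  hit⇒witness y (lower b) sol (0<y+b , y+b≤D) = window-any 0<y+b y+b≤D (subst Sol (sym (cancel y b)) sol)
    where cancel : ∀ y b → y + b - b ≡ y
          cancel = solve-∀

  ¬hit⇒far : ∀ y c → ¬ IsLower (Hit y) c → OnLower (λ b → 0ℤ < y + b → + D < y + b) c
  ¬hit⇒far y (lower b)    ¬hit 0<y+b = ℤ.≰⇒> (λ y+b≤D → ¬hit (0<y+b , y+b≤D))
  ¬hit⇒far y (upper b)    _ = tt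
  ¬hit⇒far y (const b)    _ = tt
  ¬hit⇒far y (dvd m c b)  _ = tt
  ¬hit⇒far y (ndvd m c b) _ = tt

  Below : ℤ → ℕ → Constraint ℤ → Set
  Below y N = OnLower (λ b → y + b ≤ + (N ℕ.* D))

  below-step : ∀ y N c → Below y (suc N) c → Below (y - + D) N c
  below-step y N (lower b) y+b≤D+ND =
    subst₂ _≤_ (shuffle y b (+ D)) (cancel (+ D) (+ (N ℕ.* D))) (ℤ.+-monoˡ-≤ (- + D) y+b≤D+ND)
    where shuffle : ∀ y b D → y + b - D ≡ y - D + b
          shuffle = solve-∀
          cancel : ∀ D M → D + M - D ≡ M
          cancel = solve-∀
  below-step y N (upper b)    _ = tt
  below-step y N (const b)    _ = tt
  below-step y N (dvd m c b)  _ = tt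
  below-step y N (ndvd m c b) _ = tt

  -- Descend by steps of D: within N steps either some lower bound is hit, or all of them lie below y.
  descend : ∀ N y → All (Below y N ∘ ⟦_⟧) (atoms G) → Sol y → Disjunction
  descend zero y below sol =
    inj₁ (window-periodic D sol∞-periodic y
            (holds-mono G (All.map (λ {a} → to-minusInf D ⟦ a ⟧ y) below) sol))
  descend (suc N) y below sol with Any.any? (isLower? (hit? y) ∘ ⟦_⟧) (atoms G)
  ... | yes hit = inj₂ (Any.map (λ {a} → hit⇒witness y ⟦ a ⟧ sol) hit)
  ... | no ¬hit = descend N (y - + D) (All.map (λ {a} → below-step y N ⟦ a ⟧) below)
                    (holds-mono G steps sol)
    where fars = All.map (λ {a} → ¬hit⇒far y ⟦ a ⟧) (All.¬Any⇒All¬ (atoms G) ¬hit)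
          steps = All.zipWith (λ {a} (p , far) → step-down D ⟦ a ⟧ y p far) (periods , fars)

  exists⇒disjunction : ∃ Sol → Disjunction
  exists⇒disjunction (y , sol) =
    descend N y (All.map (λ {a} → gap-below ⟦ a ⟧) (≤-sum (gap ∘ ⟦_⟧) (atoms G))) sol
    where
      gap : Constraint ℤ → ℕ
      gap (lower b) = ∣ y + b ∣
      gap _         = 0
      N = sum (map (gap ∘ ⟦_⟧) (atoms G))
      gap-below : ∀ c → gap c ℕ.≤ N → Below y N c
      gap-below (lower b)    g≤N = ℤ.≤-trans (i≤+∣i∣ (y + b)) (+≤+ (ℕ.≤-trans g≤N (ℕ.m≤m*n N D)))
      gap-below (upper b)    _ = tt
      gap-below (const b)    _ = tt
      gap-below (dvd m c b)  _ = tt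
      gap-below (ndvd m c b) _ = tt

  witness⇒exists : ∀ c → LowerWitness c → ∃ Sol
  witness⇒exists (lower b) w = let (j , sol) = Any.satisfied w in j - b , sol

  -- A solution at -∞, shifted by a multiple of D below every upper bound, is a genuine solution.
  minusInf⇒exists : ∀ j → Sol∞ j → ∃ Sol
  minusInf⇒exists j sol∞ =
    y , holds-mono G (All.map (λ {a} → from-minusInf D ⟦ a ⟧ y) uppers) (sol∞-periodic j z sol∞)
    where
      size : Constraint ℤ → ℕ
      size (upper b) = ∣ b ∣
      size _         = 0
      M = sum (map (size ∘ ⟦_⟧) (atoms G))
      z = proj₁ (shift-below D j (- + M))
      y = j + + D * z
      y<-M : y < - + M
      y<-M = proj₂ (shift-below D j (- + M))
      upper-holds : ∀ c → size c ℕ.≤ M → OnUpper (λ b → y ⊨ upper b) c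
      upper-holds (upper b) ∣b∣≤M = subst (0ℤ <_) (ℤ.+-comm b (- y))
        (to <⇔0<- (ℤ.<-≤-trans y<-M (ℤ.≤-trans (ℤ.neg-mono-≤ (+≤+ ∣b∣≤M)) (-∣i∣≤i b))))
      upper-holds (lower b)    _ = tt
      upper-holds (const b)    _ = tt
      upper-holds (dvd m c b)  _ = tt
      upper-holds (ndvd m c b) _ = tt
      uppers = All.map (λ {a} → upper-holds ⟦ a ⟧) (≤-sum (size ∘ ⟦_⟧) (atoms G))

  cooper : ∃ Sol ⇔ Disjunction
  cooper = mk⇔ exists⇒disjunction
    [ (λ w → let (j , sol∞) = Any.satisfied w in minusInf⇒exists j sol∞)
    , (λ w → let (a , wit) = Any.satisfied w in witness⇒exists ⟦ a ⟧ wit) ]′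

-- Quantifier elimination for L⁺_R

module Elimination {X : Set} (R : FunRing X) where
  open FunRing R
  open Syntax R

  record QFCond {n} (k : ℕ) (φ : Formula n) : Set where
    constructor qfCond
    field
      qf    : QF φ
      cond1 : Cond1 φ
      cond2 : Cond2 k φ

  notF-qf : ∀ {n k} {φ : Formula n} → QFCond k φ → QFCond k (notF φ)
  notF-qf (qfCond q c₁ c₂) = qfCond q c₁ c₂

  andF-qf : ∀ {n k} {φ ψ : Formula n} → QFCond k φ → QFCond k ψ → QFCond k (andF φ ψ)
  andF-qf (qfCond q c₁ c₂) (qfCond q′ c₁′ c₂′) = qfCond (q , q′) (c₁ , c₁′) (c₂ , c₂′)

  orF-qf : ∀ {n k} {φ ψ : Formula n} → QFCond k φ → QFCond k ψ → QFCond k (orF φ ψ)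
  orF-qf (qfCond q c₁ c₂) (qfCond q′ c₁′ c₂′) = qfCond (q , q′) (c₁ , c₁′) (c₂ , c₂′)

  constant-isConst : ∀ c → IsConst {X} (λ _ → c)
  constant-isConst c = c , λ _ → refl

  AdmTerm : ℕ → ℕ → Set
  AdmTerm n k = Σ (Term n) (Cond2T k)

  module _ {n k : ℕ} where

    val : X → (Fin n → ℤ) → AdmTerm n k → ℤ
    val t ρ (s , _) = evalT t ρ s

    0ₜ 1ₜ : AdmTerm n k
    0ₜ = zer , tt
    1ₜ = one , tt

    infixl 6 _+ₜ_
    _+ₜ_ : AdmTerm n k → AdmTerm n k → AdmTerm n k
    (s , p) +ₜ (s′ , p′) = add s s′ , p , p′

    infix 8 -ₜ_
    -ₜ_ : AdmTerm n k → AdmTerm n k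
    -ₜ (s , p) = neg s , p

    infixr 7 _·ₜ_
    _·ₜ_ : ℤ → AdmTerm n k → AdmTerm n k
    c ·ₜ (s , p) = smul (λ _ → c) (const-mem c) s , (λ _ → constant-isConst c) , p

    constₜ : ℤ → AdmTerm n k
    constₜ c = c ·ₜ 1ₜ

  record Linear (n k : ℕ) : Set where
    constructor _·y+_
    field
      coeff : ℤ
      rest  : AdmTerm n k

  linVal : ∀ {n k} → X → (Fin n → ℤ) → ℤ → Linear n k → ℤ
  linVal t ρ y (c ·y+ s) = c * y + val t ρ s

  _⊖_ : ∀ {n k} → Linear n k → Linear n k → Linear n k
  (a ·y+ s) ⊖ (b ·y+ s′) = (a - b) ·y+ (s +ₜ -ₜ s′)

  linVal-⊖ : ∀ {n k} t ρ y (l l′ : Linear n k) →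
             linVal t ρ y (l ⊖ l′) ≡ linVal t ρ y l - linVal t ρ y l′
  linVal-⊖ t ρ y (a ·y+ s) (b ·y+ s′) = sub-linear a b y (val t ρ s) (val t ρ s′)
    where sub-linear : ∀ a b y e e′ → (a - b) * y + (e + - e′) ≡ (a * y + e) - (b * y + e′)
          sub-linear = solve-∀

  hasBound? : ∀ {n} k (u : Term n) → Dec (HasBound k u)
  hasBound? k (var i)      = toℕ i ℕ.<? k
  hasBound? k zer          = no λ ()
  hasBound? k one          = no λ ()
  hasBound? k (neg u)      = hasBound? k u
  hasBound? k (add u v)    = hasBound? k u ⊎-dec hasBound? k v
  hasBound? k (smul _ _ u) = hasBound? k u

  record Linearization {n} (k : ℕ) (u : Term (suc n)) : Set where
    field
      linear           : Linear n k
      linVal-≡         : ∀ t ρ y → evalT t (extend y ρ) u ≡ linVal t ρ y linear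
      no-bound⇒coeff≡0 : ¬ HasBound (suc k) u → Linear.coeff linear ≡ 0ℤ
      rest-bound⇒bound : HasBound k (proj₁ (Linear.rest linear)) → HasBound (suc k) u

  private
    x≡0*y+x : ∀ y x → x ≡ 0ℤ * y + x
    x≡0*y+x = solve-∀

  -- Condition (2) is what makes every term linear in the innermost bound variable y:
  -- a non-constant α only ever multiplies subterms that contain no bound variable.
  linearize : ∀ {n} k (u : Term (suc n)) → Cond2T (suc k) u → Linearization k u
  linearize k (var zero) _ = record
    { linear = 1ℤ ·y+ 0ₜ ; linVal-≡ = λ _ _ y → y≡1*y+0 y
    ; no-bound⇒coeff≡0 = λ no-bound → ⊥-elim (no-bound (s≤s z≤n)) ; rest-bound⇒bound = λ () }
    where y≡1*y+0 : ∀ y → y ≡ 1ℤ * y + 0ℤ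
          y≡1*y+0 = solve-∀
  linearize k (var (suc i)) _ = record
    { linear = 0ℤ ·y+ (var i , tt) ; linVal-≡ = λ _ ρ y → x≡0*y+x y (ρ i)
    ; no-bound⇒coeff≡0 = λ _ → refl ; rest-bound⇒bound = s≤s }
  linearize k zer _ = record
    { linear = 0ℤ ·y+ 0ₜ ; linVal-≡ = λ _ _ y → x≡0*y+x y 0ℤ
    ; no-bound⇒coeff≡0 = λ _ → refl ; rest-bound⇒bound = λ () }
  linearize k one _ = record
    { linear = 0ℤ ·y+ 1ₜ ; linVal-≡ = λ _ _ y → x≡0*y+x y 1ℤ
    ; no-bound⇒coeff≡0 = λ _ → refl ; rest-bound⇒bound = λ () }
  linearize k (neg u) ok = record
    { linear = (- c) ·y+ (-ₜ s)
    ; linVal-≡ = λ t ρ y → trans (cong -_ (linVal-≡ t ρ y)) (neg-linear c y (val t ρ s))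
    ; no-bound⇒coeff≡0 = cong -_ ∘ no-bound⇒coeff≡0 ; rest-bound⇒bound = rest-bound⇒bound }
    where open Linearization (linearize k u ok)
          open Linear linear renaming (coeff to c; rest to s)
          neg-linear : ∀ c y e → - (c * y + e) ≡ - c * y + - e
          neg-linear = solve-∀
  linearize k (add u v) (ok-u , ok-v) = record
    { linear = (c + d) ·y+ (s +ₜ s′)
    ; linVal-≡ = λ t ρ y → trans (cong₂ _+_ (U.linVal-≡ t ρ y) (V.linVal-≡ t ρ y))
                                 (add-linear c d y (val t ρ s) (val t ρ s′))
    ; no-bound⇒coeff≡0 = λ no-bound → cong₂ _+_ (U.no-bound⇒coeff≡0 (no-bound ∘ inj₁))
                                                 (V.no-bound⇒coeff≡0 (no-bound ∘ inj₂))
    ; rest-bound⇒bound = ⊎.map U.rest-bound⇒bound V.rest-bound⇒bound }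
    where module U = Linearization (linearize k u ok-u)
          module V = Linearization (linearize k v ok-v)
          open Linear U.linear renaming (coeff to c; rest to s)
          open Linear V.linear renaming (coeff to d; rest to s′)
          add-linear : ∀ c d y e e′ → (c * y + e) + (d * y + e′) ≡ (c + d) * y + (e + e′)
          add-linear = solve-∀
  linearize k (smul α α∈R u) (bound⇒const , ok) with hasBound? (suc k) u
  ... | yes bound = record
    { linear = (a * c) ·y+ (smul α α∈R (proj₁ s) , (λ _ → α-const) , proj₂ s)
    ; linVal-≡ = λ t ρ y → trans (cong (α t *_) (linVal-≡ t ρ y))
        (subst (λ αt → αt * (c * y + val t ρ s) ≡ a * c * y + αt * val t ρ s) (sym (α≡a t))
               (scale-linear a c y (val t ρ s)))
    ; no-bound⇒coeff≡0 = λ no-bound → ⊥-elim (no-bound bound) ; rest-bound⇒bound = λ _ → bound }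
    where open Linearization (linearize k u ok)
          open Linear linear renaming (coeff to c; rest to s)
          α-const = bound⇒const bound
          a = proj₁ α-const
          α≡a = proj₂ α-const
          scale-linear : ∀ a c y e → a * (c * y + e) ≡ a * c * y + a * e
          scale-linear = solve-∀
  ... | no no-bound = record
    { linear = 0ℤ ·y+ (smul α α∈R (proj₁ s) , bound⇒const ∘ rest-bound⇒bound , proj₂ s)
    ; linVal-≡ = λ t ρ y → trans (cong (α t *_) (linVal-≡ t ρ y))
        (subst (λ c → α t * (c * y + val t ρ s) ≡ 0ℤ * y + α t * val t ρ s)
               (sym (no-bound⇒coeff≡0 no-bound)) (drop-y (α t) y (val t ρ s)))
    ; no-bound⇒coeff≡0 = λ _ → refl ; rest-bound⇒bound = rest-bound⇒bound }
    where open Linearization (linearize k u ok)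
          open Linear linear renaming (coeff to c; rest to s)
          drop-y : ∀ a y e → a * (0ℤ * y + e) ≡ 0ℤ * y + a * e
          drop-y = solve-∀

  lin : ∀ {n} k (u : Term (suc n)) → Cond2T (suc k) u → Linear n k
  lin k u ok = Linearization.linear (linearize k u ok)

  data LinAtom (n k : ℕ) : Set where
    pos      : Linear n k → LinAtom n k
    dvd ndvd : ℤ → Linear n k → LinAtom n k

  module _ {n k : ℕ} (t : X) (ρ : Fin n → ℤ) (y : ℤ) where

    LinHolds : LinAtom n k → Set
    LinHolds (pos l)    = 0ℤ < linVal t ρ y l
    LinHolds (dvd m l)  = D⟨ m ⟩ (linVal t ρ y l)
    LinHolds (ndvd m l) = ¬ D⟨ m ⟩ (linVal t ρ y l)

    linHolds? : ∀ a → Dec (LinHolds a)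
    linHolds? (pos l)    = 0ℤ ℤ.<? linVal t ρ y l
    linHolds? (dvd m l)  = D? m (linVal t ρ y l)
    linHolds? (ndvd m l) = ¬? (D? m (linVal t ρ y l))

  negate : ∀ {n k} → LinAtom n k → LinAtom n k
  negate (pos (c ·y+ s)) = pos ((- c) ·y+ (1ₜ +ₜ -ₜ s))
  negate (dvd m l)       = ndvd m l
  negate (ndvd m l)      = dvd m l

  negate-holds : ∀ {n k} t ρ y (a : LinAtom n k) → LinHolds t ρ y (negate a) ⇔ (¬ LinHolds t ρ y a)
  negate-holds t ρ y (pos (c ·y+ s)) =
    subst (λ x → 0ℤ < x ⇔ (¬ 0ℤ < c * y + val t ρ s)) (neg-linear c y (val t ρ s)) (⇔-sym ≮0⇔0<1-)
    where neg-linear : ∀ c y e → 1ℤ - (c * y + e) ≡ - c * y + (1ℤ + - e)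
          neg-linear = solve-∀
  negate-holds t ρ y (dvd m l)  = ⇔-id _
  negate-holds t ρ y (ndvd m l) = mk⇔ (λ d ¬d → ¬d d) (decidable-stable (D? m (linVal t ρ y l)))

  lessThan : ∀ {n k} → Linear n k → Linear n k → LinAtom n k
  lessThan l l′ = pos (l′ ⊖ l)

  lessThan-holds : ∀ {n k} t ρ y (l l′ : Linear n k) →
                   LinHolds t ρ y (lessThan l l′) ⇔ linVal t ρ y l < linVal t ρ y l′
  lessThan-holds t ρ y l l′ =
    subst (λ x → 0ℤ < x ⇔ linVal t ρ y l < linVal t ρ y l′) (sym (linVal-⊖ t ρ y l′ l)) (⇔-sym <⇔0<-)

  toLinear : ∀ {n} k (ψ : Formula (suc n)) → QF ψ → Cond1 ψ → Cond2 (suc k) ψ → AndOr (LinAtom n k)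
  toLinear k (eqF u v) _ _ (ok-u , ok-v) =
    atom (negate (lessThan (lin k u ok-u) (lin k v ok-v))) ∧ atom (negate (lessThan (lin k v ok-v) (lin k u ok-u)))
  toLinear k (ltF u v) _ _ (ok-u , ok-v) = atom (lessThan (lin k u ok-u) (lin k v ok-v))
  toLinear k (dvdF α _ u) _ (a , _) ok-u = atom (dvd a (lin k u ok-u))
  toLinear k (notF ψ) qf c₁ c₂ = dual negate (toLinear k ψ qf c₁ c₂)
  toLinear k (andF ψ ψ′) (qf , qf′) (c₁ , c₁′) (c₂ , c₂′) =
    toLinear k ψ qf c₁ c₂ ∧ toLinear k ψ′ qf′ c₁′ c₂′
  toLinear k (orF ψ ψ′) (qf , qf′) (c₁ , c₁′) (c₂ , c₂′) =
    toLinear k ψ qf c₁ c₂ ∨ toLinear k ψ′ qf′ c₁′ c₂′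

  toLinear-holds : ∀ {n} k (ψ : Formula (suc n)) qf c₁ c₂ t ρ y →
                   Holds (LinHolds t ρ y) (toLinear k ψ qf c₁ c₂) ⇔ Sat t (extend y ρ) ψ
  toLinear-holds k (eqF u v) qf c₁ c₂@(ok-u , ok-v) t ρ y =
    subst₂ (λ x x′ → Holds (LinHolds t ρ y) (toLinear k (eqF u v) qf c₁ c₂) ⇔ x ≡ x′)
      (sym (U.linVal-≡ t ρ y)) (sym (V.linVal-≡ t ρ y))
      (⇔-sym ≡⇔≮×≯ ⇔-∘ (not-less U.linear V.linear ×-⇔ not-less V.linear U.linear))
    where module U = Linearization (linearize k u ok-u)
          module V = Linearization (linearize k v ok-v)
          not-less = λ l l′ → ¬-cong-⇔ (lessThan-holds t ρ y l l′) ⇔-∘ negate-holds t ρ y (lessThan l l′)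
  toLinear-holds k (ltF u v) qf c₁ c₂@(ok-u , ok-v) t ρ y =
    subst₂ (λ x x′ → Holds (LinHolds t ρ y) (toLinear k (ltF u v) qf c₁ c₂) ⇔ x < x′)
      (sym (U.linVal-≡ t ρ y)) (sym (V.linVal-≡ t ρ y)) (lessThan-holds t ρ y U.linear V.linear)
    where module U = Linearization (linearize k u ok-u)
          module V = Linearization (linearize k v ok-v)
  toLinear-holds k (dvdF α α∈R u) qf c₁@(a , α≡a) ok-u t ρ y =
    subst₂ (λ m x → Holds (LinHolds t ρ y) (toLinear k (dvdF α α∈R u) qf c₁ ok-u) ⇔ D⟨ m ⟩ x)
      (sym (α≡a t)) (sym (U.linVal-≡ t ρ y)) (⇔-id _)
    where module U = Linearization (linearize k u ok-u)
  toLinear-holds k (notF ψ) qf c₁ c₂ t ρ y =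
    ¬-cong-⇔ (toLinear-holds k ψ qf c₁ c₂ t ρ y)
      ⇔-∘ holds-dual (linHolds? t ρ y) (negate-holds t ρ y) (toLinear k ψ qf c₁ c₂)
  toLinear-holds k (andF ψ ψ′) (qf , qf′) (c₁ , c₁′) (c₂ , c₂′) t ρ y =
    toLinear-holds k ψ qf c₁ c₂ t ρ y ×-⇔ toLinear-holds k ψ′ qf′ c₁′ c₂′ t ρ y
  toLinear-holds k (orF ψ ψ′) (qf , qf′) (c₁ , c₁′) (c₂ , c₂′) t ρ y =
    toLinear-holds k ψ qf c₁ c₂ t ρ y ⊎-⇔ toLinear-holds k ψ′ qf′ c₁′ c₂′ t ρ y

  coeffOf : ∀ {n k} → LinAtom n k → ℤ
  coeffOf (pos l)    = Linear.coeff l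
  coeffOf (dvd _ l)  = Linear.coeff l
  coeffOf (ndvd _ l) = Linear.coeff l

  -- Multiplying an atom by L / ∣c∣ makes the coefficient of y equal to ±L (or leaves it 0);
  -- the result is then read as a constraint on Y = L·y.
  unitize : ∀ {n k} → ℕ → LinAtom n k → Constraint (AdmTerm n k)
  unitize L (pos (c ·y+ s))    = signed c (+ cofactor L c ·ₜ s)
  unitize L (dvd m (c ·y+ s))  = dvd (+ cofactor L c * m) (signum c) (+ cofactor L c ·ₜ s)
  unitize L (ndvd m (c ·y+ s)) = ndvd (+ cofactor L c * m) (signum c) (+ cofactor L c ·ₜ s)

  unitize-holds : ∀ {n k} L .{{_ : NonZero L}} t ρ y (a : LinAtom n k) → ∣ coeffOf a ∣⁺ ℕ.∣ L →
                  (+ L * y) ⊨ mapᶜ (val t ρ) (unitize L a) ⇔ LinHolds t ρ y a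
  unitize-holds L t ρ y (pos (c ·y+ s)) c∣L = begin
    (+ L * y) ⊨ mapᶜ (val t ρ) (signed c (+ q ·ₜ s))  ≡⟨ cong ((+ L * y) ⊨_) (mapᶜ-signed _ c _) ⟩
    (+ L * y) ⊨ signed c (+ q * e)                    ∼⟨ signed-⊨ c (+ L * y) (+ q * e) ⟩
    0ℤ < signum c * (+ L * y) + + q * e               ≡⟨ cong (0ℤ <_) (cofactor-linear c y e c∣L) ⟨
    0ℤ < + q * (c * y + e)                            ∼⟨ 0<*⇔0< q {{cofactor-nonZero c c∣L}} ⟩
    0ℤ < c * y + e                                    ∎
    where open EquationalReasoning
          q = cofactor L c
          e = val t ρ s
  unitize-holds L t ρ y (dvd m (c ·y+ s)) c∣L = begin
    D⟨ + q * m ⟩ (signum c * (+ L * y) + + q * e)  ≡⟨ cong D⟨ + q * m ⟩ (cofactor-linear c y e c∣L) ⟨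
    D⟨ + q * m ⟩ (+ q * (c * y + e))               ∼⟨ ⇔-sym (D-scale q {{cofactor-nonZero c c∣L}}) ⟩
    D⟨ m ⟩ (c * y + e)                             ∎
    where open EquationalReasoning
          q = cofactor L c
          e = val t ρ s
  unitize-holds L t ρ y (ndvd m (c ·y+ s)) c∣L = ¬-cong-⇔ (unitize-holds L t ρ y (dvd m (c ·y+ s)) c∣L)

  ⊥F : ∀ {n} → Formula n
  ⊥F = ltF zer zer

  ⊥F-qf : ∀ {n k} → QFCond k (⊥F {n})
  ⊥F-qf = qfCond tt tt (tt , tt)

  ⊥F-unsat : ∀ {n} t (ρ : Fin n → ℤ) → ¬ Sat t ρ ⊥F
  ⊥F-unsat t ρ = ℤ.<-irrefl refl

  toFormula : ∀ {n} → (A → Formula n) → AndOr A → Formula n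
  toFormula f (atom a) = f a
  toFormula f (F ∧ G)  = andF (toFormula f F) (toFormula f G)
  toFormula f (F ∨ G)  = orF (toFormula f F) (toFormula f G)

  toFormula-sat : ∀ {n} {f : A → Formula n} t ρ →
                  (∀ a → Sat t ρ (f a) ⇔ P a) → ∀ F → Sat t ρ (toFormula f F) ⇔ Holds P F
  toFormula-sat t ρ f⇔P (atom a) = f⇔P a
  toFormula-sat t ρ f⇔P (F ∧ G)  = toFormula-sat t ρ f⇔P F ×-⇔ toFormula-sat t ρ f⇔P G
  toFormula-sat t ρ f⇔P (F ∨ G)  = toFormula-sat t ρ f⇔P F ⊎-⇔ toFormula-sat t ρ f⇔P G

  toFormula-qf : ∀ {n k} {f : A → Formula n} → (∀ a → QFCond k (f a)) → ∀ F → QFCond k (toFormula f F)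
  toFormula-qf f-qf (atom a) = f-qf a
  toFormula-qf f-qf (F ∧ G)  = andF-qf (toFormula-qf f-qf F) (toFormula-qf f-qf G)
  toFormula-qf f-qf (F ∨ G)  = orF-qf (toFormula-qf f-qf F) (toFormula-qf f-qf G)

  ⋁ : ∀ {n} → List A → (A → Formula n) → Formula n
  ⋁ []       f = ⊥F
  ⋁ (x ∷ xs) f = orF (f x) (⋁ xs f)

  ⋁-sat : ∀ {n} {f : A → Formula n} t ρ →
          (∀ x → Sat t ρ (f x) ⇔ P x) → ∀ xs → Sat t ρ (⋁ xs f) ⇔ Any P xs
  ⋁-sat t ρ f⇔P []       = mk⇔ (⊥-elim ∘ ⊥F-unsat t ρ) λ ()
  ⋁-sat t ρ f⇔P (x ∷ xs) = mk⇔
    [ here ∘ to (f⇔P x) , there ∘ to (⋁-sat t ρ f⇔P xs) ]′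
    λ { (here p) → inj₁ (from (f⇔P x) p) ; (there p) → inj₂ (from (⋁-sat t ρ f⇔P xs) p) }

  ⋁-qf : ∀ {n k} {f : A → Formula n} → (∀ x → QFCond k (f x)) → ∀ xs → QFCond k (⋁ xs f)
  ⋁-qf {n = n} {k} f-qf [] = ⊥F-qf {n} {k}
  ⋁-qf f-qf (x ∷ xs)       = orF-qf (f-qf x) (⋁-qf f-qf xs)

  module _ {n k : ℕ} where

    atomAt : Constraint (AdmTerm n k) → Term n → Formula n
    atomAt (lower (b , _))   e = ltF zer (add e b)
    atomAt (upper (b , _))   e = ltF zer (add (neg e) b)
    atomAt (const (b , _))   e = ltF zer b
    atomAt (dvd m c (b , _)) e = dvdF (λ _ → m) (const-mem m) (add (smul (λ _ → c) (const-mem c) e) b)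
    atomAt (ndvd m c b)      e = notF (atomAt (dvd m c b) e)

    minusInfAt : Constraint (AdmTerm n k) → Term n → Formula n
    minusInfAt (lower _) e = ltF zer zer
    minusInfAt (upper _) e = ltF zer one
    minusInfAt c         e = atomAt c e

    atomAt-sat : ∀ t ρ c e → Sat t ρ (atomAt c e) ⇔ (evalT t ρ e ⊨ mapᶜ (val t ρ) c)
    atomAt-sat t ρ (lower _)    e = ⇔-id _
    atomAt-sat t ρ (upper _)    e = ⇔-id _
    atomAt-sat t ρ (const _)    e = ⇔-id _
    atomAt-sat t ρ (dvd _ _ _)  e = ⇔-id _
    atomAt-sat t ρ (ndvd _ _ _) e = ⇔-id _

    minusInfAt-sat : ∀ t ρ c e → Sat t ρ (minusInfAt c e) ⇔ (evalT t ρ e ⊨ minusInf (mapᶜ (val t ρ) c))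
    minusInfAt-sat t ρ (lower _)    e = ⇔-id _
    minusInfAt-sat t ρ (upper _)    e = ⇔-id _
    minusInfAt-sat t ρ (const _)    e = ⇔-id _
    minusInfAt-sat t ρ (dvd _ _ _)  e = ⇔-id _
    minusInfAt-sat t ρ (ndvd _ _ _) e = ⇔-id _

    atomAt-qf : ∀ c e → Cond2T k e → QFCond k (atomAt c e)
    atomAt-qf (lower (_ , b-ok))   e e-ok = qfCond tt tt (tt , e-ok , b-ok)
    atomAt-qf (upper (_ , b-ok))   e e-ok = qfCond tt tt (tt , e-ok , b-ok)
    atomAt-qf (const (_ , b-ok))   e e-ok = qfCond tt tt (tt , b-ok)
    atomAt-qf (dvd m c (_ , b-ok)) e e-ok =
      qfCond tt (constant-isConst m) (((λ _ → constant-isConst c) , e-ok) , b-ok)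
    atomAt-qf (ndvd m c b)         e e-ok = notF-qf (atomAt-qf (dvd m c b) e e-ok)

    minusInfAt-qf : ∀ c e → Cond2T k e → QFCond k (minusInfAt c e)
    minusInfAt-qf (lower _)      e e-ok = qfCond tt tt (tt , tt)
    minusInfAt-qf (upper _)      e e-ok = qfCond tt tt (tt , tt)
    minusInfAt-qf c@(const _)    e e-ok = atomAt-qf c e e-ok
    minusInfAt-qf c@(dvd _ _ _)  e e-ok = atomAt-qf c e e-ok
    minusInfAt-qf c@(ndvd _ _ _) e e-ok = atomAt-qf c e e-ok

  module _ {n k : ℕ} (D : ℕ) (G : AndOr (Constraint (AdmTerm n k))) where

    solutionAt minusInfSolutionAt : Term n → Formula n
    solutionAt         e = toFormula (λ c → atomAt c e) G
    minusInfSolutionAt e = toFormula (λ c → minusInfAt c e) G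

    lowerDisjunct : Constraint (AdmTerm n k) → Formula n
    lowerDisjunct (lower b) = ⋁ (window D) (λ j → solutionAt (proj₁ (constₜ j +ₜ -ₜ b)))
    lowerDisjunct _         = ⊥F

    cooperFormula : Formula n
    cooperFormula =
      orF (⋁ (window D) (minusInfSolutionAt ∘ proj₁ ∘ constₜ {n} {k})) (⋁ (atoms G) lowerDisjunct)

    cooperFormula-qf : QFCond k cooperFormula
    cooperFormula-qf =
      orF-qf (⋁-qf (λ j → toFormula-qf (λ c → minusInfAt-qf c _ (proj₂ (constₜ {n} {k} j))) G) (window D))
             (⋁-qf lowerDisjunct-qf (atoms G))
      where
        lowerDisjunct-qf : ∀ c → QFCond k (lowerDisjunct c)
        lowerDisjunct-qf (lower b)    =
          ⋁-qf (λ j → toFormula-qf (λ c → atomAt-qf c _ (proj₂ (constₜ j +ₜ -ₜ b))) G) (window D)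
        lowerDisjunct-qf (upper _)    = ⊥F-qf {n} {k}
        lowerDisjunct-qf (const _)    = ⊥F-qf {n} {k}
        lowerDisjunct-qf (dvd _ _ _)  = ⊥F-qf {n} {k}
        lowerDisjunct-qf (ndvd _ _ _) = ⊥F-qf {n} {k}

    module _ .{{_ : NonZero D}} (t : X) (ρ : Fin n → ℤ)
             (periods : All (λ c → period (mapᶜ (val t ρ) c) ℕ.∣ D) (atoms G)) where
      open Cooper (mapᶜ (val t ρ)) G D periods

      solutionAt-sat : ∀ {e y} → evalT t ρ e ≡ y → Sat t ρ (solutionAt e) ⇔ Sol y
      solutionAt-sat {e} refl = toFormula-sat t ρ (λ c → atomAt-sat t ρ c e) G

      minusInfSolutionAt-sat : ∀ {e y} → evalT t ρ e ≡ y → Sat t ρ (minusInfSolutionAt e) ⇔ Sol∞ y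
      minusInfSolutionAt-sat {e} refl = toFormula-sat t ρ (λ c → minusInfAt-sat t ρ c e) G

      lowerDisjunct-sat : ∀ c → Sat t ρ (lowerDisjunct c) ⇔ LowerWitness (mapᶜ (val t ρ) c)
      lowerDisjunct-sat (lower b)    =
        ⋁-sat t ρ (λ j → solutionAt-sat (cong (_- val t ρ b) (ℤ.*-identityʳ j))) (window D)
      lowerDisjunct-sat (upper _)    = mk⇔ (⊥F-unsat t ρ) λ ()
      lowerDisjunct-sat (const _)    = mk⇔ (⊥F-unsat t ρ) λ ()
      lowerDisjunct-sat (dvd _ _ _)  = mk⇔ (⊥F-unsat t ρ) λ ()
      lowerDisjunct-sat (ndvd _ _ _) = mk⇔ (⊥F-unsat t ρ) λ ()

      cooperFormula-sat : Sat t ρ cooperFormula ⇔ Disjunction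
      cooperFormula-sat = ⋁-sat t ρ (λ j → minusInfSolutionAt-sat (ℤ.*-identityʳ j)) (window D)
                      ⊎-⇔ ⋁-sat t ρ lowerDisjunct-sat (atoms G)

  eliminate-∃ : ∀ {n} k (ψ : Formula (suc n)) → QFCond (suc k) ψ →
                Σ (Formula n) λ χ → QFCond k χ × (∀ t ρ → Sat t ρ χ ⇔ ∃ λ y → Sat t (extend y ρ) ψ)
  eliminate-∃ {n} k ψ (qfCond qf c₁ c₂) = cooperFormula D G , cooperFormula-qf D G , sound
    where
      F = toLinear k ψ qf c₁ c₂
      L = product (map (∣_∣⁺ ∘ coeffOf) (atoms F))
      instance L≢0 = product-nonZero (∣_∣⁺ ∘ coeffOf) (∣∣⁺-nonZero ∘ coeffOf) (atoms F)
      -- a constraint on Y = L·y; its first atom says L ∣ Y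
      G : AndOr (Constraint (AdmTerm n k))
      G = atom (dvd (+ L) 1ℤ 0ₜ) ∧ mapᴬ (unitize L) F
      D = product (map period (atoms G))
      instance D≢0 = product-nonZero period period-nonZero (atoms G)
      periods : ∀ t ρ → All (λ c → period (mapᶜ (val t ρ) c) ℕ.∣ D) (atoms G)
      periods t ρ =
        All.map (λ {c} → subst (ℕ._∣ D) (sym (period-mapᶜ (val t ρ) c))) (∣-product period (atoms G))
      sound : ∀ t ρ → Sat t ρ (cooperFormula D G) ⇔ ∃ λ y → Sat t (extend y ρ) ψ
      sound t ρ = begin
        Sat t ρ (cooperFormula D G)
          ∼⟨ cooperFormula-sat D G t ρ (periods t ρ) ⟩
        C.Disjunction
          ∼⟨ ⇔-sym C.cooper ⟩
        ∃ C.Sol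
          ∼⟨ ∃-cong (λ Y → subst (λ x → D⟨ + L ⟩ x ⇔ D⟨ + L ⟩ Y) (sym (1*Y+0≡Y Y)) (⇔-id _)
                           ×-⇔ holds-map (unitize L) F) ⟩
        (∃ λ Y → D⟨ + L ⟩ Y × Holds (λ a → Y ⊨ mapᶜ (val t ρ) (unitize L a)) F)
          ∼⟨ ⇔-sym (∃-scale L _) ⟩
        (∃ λ y → Holds (λ a → (+ L * y) ⊨ mapᶜ (val t ρ) (unitize L a)) F)
          ∼⟨ ∃-cong (λ y → holds-cong F (All.map (λ {a} → unitize-holds L t ρ y a)
                                                 (∣-product (∣_∣⁺ ∘ coeffOf) (atoms F)))) ⟩
        (∃ λ y → Holds (LinHolds t ρ y) F)
          ∼⟨ ∃-cong (toLinear-holds k ψ qf c₁ c₂ t ρ) ⟩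
        (∃ λ y → Sat t (extend y ρ) ψ) ∎
        where open EquationalReasoning
              module C = Cooper (mapᶜ (val t ρ)) G D (periods t ρ)
              1*Y+0≡Y : ∀ Y → 1ℤ * Y + 0ℤ ≡ Y
              1*Y+0≡Y = solve-∀

  sat? : ∀ {n} t ρ (φ : Formula n) → QF φ → Dec (Sat t ρ φ)
  sat? t ρ (eqF s s′)   _          = evalT t ρ s ℤ.≟ evalT t ρ s′
  sat? t ρ (ltF s s′)   _          = evalT t ρ s ℤ.<? evalT t ρ s′
  sat? t ρ (dvdF α _ s) _          = D? (α t) (evalT t ρ s)
  sat? t ρ (notF φ)     qf         = ¬? (sat? t ρ φ qf)
  sat? t ρ (andF φ ψ)   (qf , qf′) = sat? t ρ φ qf ×-dec sat? t ρ ψ qf′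
  sat? t ρ (orF φ ψ)    (qf , qf′) = sat? t ρ φ qf ⊎-dec sat? t ρ ψ qf′

  qe : ∀ {n} k (φ : Formula n) → Cond1 φ → Cond2 k φ → Σ (Formula n) λ ψ → QFCond k ψ × LogEquiv φ ψ
  qe k φ@(eqF _ _)    c₁ c₂ = φ , qfCond tt c₁ c₂ , λ _ _ → ⇔-id _
  qe k φ@(ltF _ _)    c₁ c₂ = φ , qfCond tt c₁ c₂ , λ _ _ → ⇔-id _
  qe k φ@(dvdF _ _ _) c₁ c₂ = φ , qfCond tt c₁ c₂ , λ _ _ → ⇔-id _
  qe k (notF φ) c₁ c₂ =
    let (ψ , ψ-qf , φ⇔ψ) = qe k φ c₁ c₂ in notF ψ , notF-qf ψ-qf , λ t ρ → ¬-cong-⇔ (φ⇔ψ t ρ)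
  qe k (andF φ φ′) (c₁ , c₁′) (c₂ , c₂′) =
    let (ψ , ψ-qf , φ⇔ψ) = qe k φ c₁ c₂ ; (ψ′ , ψ′-qf , φ′⇔ψ′) = qe k φ′ c₁′ c₂′
    in andF ψ ψ′ , andF-qf ψ-qf ψ′-qf , λ t ρ → φ⇔ψ t ρ ×-⇔ φ′⇔ψ′ t ρ
  qe k (orF φ φ′) (c₁ , c₁′) (c₂ , c₂′) =
    let (ψ , ψ-qf , φ⇔ψ) = qe k φ c₁ c₂ ; (ψ′ , ψ′-qf , φ′⇔ψ′) = qe k φ′ c₁′ c₂′
    in orF ψ ψ′ , orF-qf ψ-qf ψ′-qf , λ t ρ → φ⇔ψ t ρ ⊎-⇔ φ′⇔ψ′ t ρ
  qe k (exF φ) c₁ c₂ =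
    let (ψ , ψ-qf , φ⇔ψ) = qe (suc k) φ c₁ c₂ ; (χ , χ-qf , χ⇔∃) = eliminate-∃ k ψ ψ-qf
    in χ , χ-qf , λ t ρ → ⇔-sym (χ⇔∃ t ρ) ⇔-∘ ∃-cong (λ y → φ⇔ψ t (extend y ρ))
  qe k (allF φ) c₁ c₂ =
    let (ψ , ψ-qf , φ⇔ψ) = qe (suc k) φ c₁ c₂
        (χ , χ-qf , χ⇔∃¬) = eliminate-∃ k (notF ψ) (notF-qf ψ-qf)
    in notF χ , notF-qf χ-qf , λ t ρ →
         ¬-cong-⇔ (⇔-sym (χ⇔∃¬ t ρ))
           ⇔-∘ (∀⇔¬∃¬ (λ y → sat? t (extend y ρ) ψ (QFCond.qf ψ-qf))
           ⇔-∘ ∀-cong (λ y → φ⇔ψ t (extend y ρ)))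

theorem1p5 : (X : Set) → X → (R : FunRing X) → (d : ℕ) →
    (φ : Syntax.Formula R d) → Syntax.Cond1 R φ → Syntax.Cond2 R 0 φ →
    Σ (Syntax.Formula R d) (λ ψ →
    Syntax.QF R ψ × Syntax.Cond1 R ψ × Syntax.LogEquiv R φ ψ)
theorem1p5 X _ R d φ c₁ c₂ =
  let (ψ , Elimination.qfCond qf ψ-c₁ _ , φ⇔ψ) = Elimination.qe R 0 φ c₁ c₂ in ψ , qf , ψ-c₁ , φ⇔ψ
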